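{- Let $G$ be a parity game all of whose node colors are in $\{0,1\}$. Then $\mathtt{psolB}$ completely solves $G$, i.e. $\mathtt{psolB}(G)$ is the empty game.
   Context: A parity game is a tuple $G=(V,V_0,V_1,E,c)$ where $V$ is a finite set of nodes partitioned into $V_0,V_1$, $E\subseteq V\times V$ with every node having a successor, and $c\colon V\to\mathbb{N}$. Let $v.E=\{w\mid(v,w)\in E\}$. For $U\subseteq V$, $G\setminus U$ is the game restricted to $V\setminus U$. $\mathrm{Attr}_p(G,X)$ is the least fixed point of $Z\mapsto X\cup\{v\in V_p\mid v.E\cap Z\ne\emptyset\}\cup\{v\in V_{1-p}\mid v.E\subseteq Z\}$. Let $\mathrm{mpre}_p(A,X,d)=\{v\in V_p\mid c(v)\geq d \wedge v.E\cap(A\cup X)\neq\emptyset\}\cup\{v\in V_{1-p}\mid c(v)\geq d\wedge v.E\subseteq A\cup X\}$; for a nonempty set $X$ of nodes of common color $d$, $\mathrm{MAttr}(X)$ is the least fixed point of $Z\mapsto\mathrm{mpre}_{d\bmod 2}(Z,X,d)$ in the current game. Algorithm $\mathtt{psolB}(G)$: for each color $d$ of $G$ in descending order: let $X$ be the set of nodes of color $d$; repeat: if $X=\emptyset$ go to the next color; if $X\subseteq\mathrm{MAttr}(X)$, return $\mathtt{psolB}(G\setminus\mathrm{Attr}_{d\bmod 2}(G,\mathrm{MAttr}(X)))$; else set $X:=X\cap\mathrm{MAttr}(X)$. If all colors are processed, return $G$. (The removed sets are classified as won by player $d\bmod 2$.) -}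

module Defs where

open import Level using (Level) renaming (suc to lsuc)
open import Data.Nat using (ℕ; zero; suc; _≤_; _⊔_)
open import Data.Nat.DivMod using (_mod_)
open import Data.Fin using (Fin)
open import Data.Bool using (Bool; true)
open import Data.List using (foldr; map; allFin)
open import Data.Product using (Σ; ∃; _×_; _,_)
open import Data.Sum using (_⊎_)
open import Data.Unit using (⊤)
open import Relation.Nullary using (¬_)
open import Relation.Binary.PropositionalEquality using (_≡_; _≢_)

-- A parity game on the node set Fin n.
--   owner v ≡ 0  means v ∈ V₀,  owner v ≡ 1  means v ∈ V₁.
--   (v , w) ∈ E  iff  edge v w ≡ true   (decidable edge relation).
--   every node has a successor.
--   c is the colouring.

record ParityGame : Set where
  field
    n     : ℕ
    owner : Fin n → Fin 2
    edge  : Fin n → Fin n → Bool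
    total : ∀ v → ∃ λ w → edge v w ≡ true
    c     : Fin n → ℕ

parity : ℕ → Fin 2
parity d = d mod 2

module _ (G : ParityGame) where
  open ParityGame G

  NSet : Set₁
  NSet = Fin n → Set

  E : Fin n → Fin n → Set
  E v w = edge v w ≡ true

  _⊆_ : NSet → NSet → Set
  A ⊆ B = ∀ v → A v → B v

  _∩_ : NSet → NSet → NSet
  (A ∩ B) v = A v × B v

  _∖_ : NSet → NSet → NSet
  (U ∖ A) v = U v × ¬ A v

  IsEmpty : NSet → Set
  IsEmpty A = ∀ v → ¬ A v

  Full : NSet
  Full _ = ⊤

  -- The subgame currently under consideration is given by its node set U;
  -- its edges are the edges of G between nodes of U.

  -- Attr_p(U, X): least fixed point of
  --   Z ↦ X ∪ {v ∈ V_p | v.E ∩ Z ≠ ∅} ∪ {v ∈ V_{1-p} | v.E ⊆ Z}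
  -- in the subgame with node set U (X is assumed ⊆ U), as an inductive predicate.
  data Attr (p : Fin 2) (U X : NSet) : NSet where
    attr-base : ∀ {v} → X v → Attr p U X v
    attr-own  : ∀ {v} w → U v → owner v ≡ p →
                E v w → U w → Attr p U X w → Attr p U X v
    attr-opp  : ∀ {v} → U v → owner v ≢ p →
                (∀ w → E v w → U w → Attr p U X w) → Attr p U X v

  -- MAttr(X) for colour d in the subgame U: least fixed point of
  --   Z ↦ mpre_{d mod 2}(Z, X, d).
  data MAttr (d : ℕ) (U X : NSet) : NSet where
    mattr-own : ∀ {v} w → U v → owner v ≡ parity d → d ≤ c v →
                E v w → U w → (MAttr d U X w ⊎ X w) → MAttr d U X v
    mattr-opp : ∀ {v} → U v → owner v ≢ parity d → d ≤ c v →
                (∀ w → E v w → U w → MAttr d U X w ⊎ X w) → MAttr d U X v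

  ColorSet : NSet → ℕ → NSet
  ColorSet U d v = U v × c v ≡ d

  maxColor : ℕ
  maxColor = foldr _⊔_ 0 (map c (allFin n))

  -- Big-step semantics of psolB.
  --   PsolB U R     : psolB applied to the subgame U terminates with result R.
  --   Loop U d X R  : within psolB(U), processing colour d with current set X,
  --                   the run terminates with result R.
  -- Colours are processed in descending order from maxColor down to 0;
  -- a value d that is not a colour of U gives X = ∅ immediately and hence just
  -- moves on to the next colour, exactly as skipping it would.
  data PsolB : NSet → NSet → Set₁
  data Loop  : NSet → ℕ → NSet → NSet → Set₁

  data PsolB where
    run : ∀ {U R} → Loop U maxColor (ColorSet U maxColor) R → PsolB U R

  data Loop where
    empty-next : ∀ {U d X R} → IsEmpty X →
                 Loop U d (ColorSet U d) R → Loop U (suc d) X R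
    empty-done : ∀ {U X} → IsEmpty X → Loop U zero X U
    recurse    : ∀ {U d X R} → ¬ IsEmpty X → X ⊆ MAttr d U X →
                 PsolB (U ∖ Attr (parity d) U (MAttr d U X)) R →
                 Loop U d X R
    shrink     : ∀ {U d X R} → ¬ IsEmpty X → ¬ (X ⊆ MAttr d U X) →
                 Loop U d (X ∩ MAttr d U X) R → Loop U d X R

-- The argument is by strong recursion on the size of the current subgame U
-- (a set of nodes each having a successor in U).  Every run of psolB either empties
-- U or finds a nonempty X ⊆ MAttr(X); then X lies in the attractor that psolB
-- removes, so it recurses on a strictly smaller subgame.
--
-- Colour 1.  A "monochrome 1-trap" is a set W of colour-1 nodes in which player 1
-- can keep the play forever.  Every such W with W ⊆ X satisfies W ⊆ MAttr(X), so
-- the invariant "every monochrome 1-trap is contained in X" survives the shrinking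
-- step X := X ∩ MAttr(X).  If X becomes empty, U has no nonempty monochrome 1-trap.
--
-- Colour 0.  Without monochrome 1-traps, the nodes of U outside MAttr(X₀) ∪ X₀
-- (X₀ = the colour-0 nodes) form such a trap, so U ⊆ MAttr(X₀) ∪ X₀; hence either
-- X₀ = ∅ and U itself is a 1-trap, i.e. U = ∅, or X₀ ⊆ MAttr(X₀) and psolB recurses.
module Submission where

open import Defs
open import Data.Nat using (ℕ; zero; suc; _≤_; _<_; _⊔_; _≤?_; _≟_; z≤n; s≤s)
open import Data.Nat.Properties
  using ( ≤-refl; ≤-trans; ≤-antisym; ≤-reflexive; <-≤-trans; ≤-pred; 1+n≰n; n≢0⇒n>0
        ; ⊔-lub; m≤n⇒m≤n⊔o; m≤n⇒m≤o⊔n )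
open import Data.Bool using (true) renaming (_≟_ to _≟ᵇ_)
open import Data.Fin using (Fin; zero; suc) renaming (_≟_ to _≟ᶠ_)
open import Data.Fin.Properties using (any?; all?)
open import Data.Fin.Subset using (Subset; _∈_; ∣_∣)
open import Data.Fin.Subset.Properties using (p⊂q⇒∣p∣<∣q∣; ∣p∣≤n)
open import Data.Vec using (tabulate)
open import Data.Vec.Properties using (lookup∘tabulate; lookup⇒[]=; []=⇒lookup)
open import Data.List using (map; allFin)
open import Data.List.Properties using (foldr-preservesᵇ; foldr-preservesᵒ)
open import Data.List.Relation.Unary.All.Properties as All using ()
open import Data.List.Relation.Unary.Any.Properties as Any using ()
open import Data.Product using (∃; _×_; _,_; proj₁; proj₂)
open import Data.Sum using (_⊎_; inj₁; inj₂; [_,_]′)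
open import Data.Empty using (⊥; ⊥-elim)
open import Data.Unit using (tt)
open import Level using (0ℓ)
open import Relation.Nullary using (¬_; Dec; yes; no; does)
open import Relation.Nullary.Decidable
  using (dec-true; _×-dec_; _⊎-dec_; _→-dec_; ¬?; decidable-stable)
open import Relation.Unary using (Pred; Decidable; _⊆′_)
open import Relation.Binary.PropositionalEquality using (_≡_; _≢_; refl; sym; trans)

module _ {n : ℕ} where

  -- For decidable P and Q on a finite set, either P ⊆ Q or some element of P
  -- lies outside Q.  This is how every case split of psolB is made constructive.
  inclusion-or-escape : {P Q : Pred (Fin n) 0ℓ} → Decidable P → Decidable Q →
                        P ⊆′ Q ⊎ ∃ (λ v → P v × ¬ Q v)
  inclusion-or-escape P? Q? with any? (λ v → P? v ×-dec ¬? (Q? v))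
  ... | yes escape = inj₂ escape
  ... | no ¬escape = inj₁ λ v p → decidable-stable (Q? v) (λ ¬q → ¬escape (v , p , ¬q))

  empty-or-inhabited : {P : Pred (Fin n) 0ℓ} → Decidable P → (∀ v → ¬ P v) ⊎ ∃ P
  empty-or-inhabited P? with any? P?
  ... | yes inhabited = inj₂ inhabited
  ... | no ¬inhabited = inj₁ λ v p → ¬inhabited (v , p)

  -- The subset of Fin n cut out by a decidable predicate, and its two membership
  -- directions; the cardinality of this subset is the measure of every recursion below.
  toSubset : {P : Pred (Fin n) 0ℓ} → Decidable P → Subset n
  toSubset P? = tabulate (λ v → does (P? v))

  ∈-toSubset⁺ : {P : Pred (Fin n) 0ℓ} (P? : Decidable P) {v : Fin n} →
                P v → v ∈ toSubset P?
  ∈-toSubset⁺ P? {v} p = lookup⇒[]= v _ (trans (lookup∘tabulate _ v) (dec-true (P? v) p))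

  ∈-toSubset⁻ : {P : Pred (Fin n) 0ℓ} (P? : Decidable P) {v : Fin n} →
                v ∈ toSubset P? → P v
  ∈-toSubset⁻ P? {v} v∈P
    with P? v | trans (sym (lookup∘tabulate (λ w → does (P? w)) v)) ([]=⇒lookup v∈P)
  ... | yes p | _  = p
  ... | no _  | ()

  size : {P : Pred (Fin n) 0ℓ} → Decidable P → ℕ
  size P? = ∣ toSubset P? ∣

  size≤n : {P : Pred (Fin n) 0ℓ} (P? : Decidable P) → size P? ≤ n
  size≤n P? = ∣p∣≤n (toSubset P?)

  size-< : {P Q : Pred (Fin n) 0ℓ} (P? : Decidable P) (Q? : Decidable Q) →
           P ⊆′ Q → ∃ (λ v → Q v × ¬ P v) → size P? < size Q?
  size-< P? Q? P⊆Q (v , q , ¬p) = p⊂q⇒∣p∣<∣q∣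
    ( (λ m → ∈-toSubset⁺ Q? (P⊆Q _ (∈-toSubset⁻ P? m)))
    , v , ∈-toSubset⁺ Q? q , λ m → ¬p (∈-toSubset⁻ P? m))

-- Least fixed points of a monotone operator F on predicates over Fin n that
-- preserves decidability: the Kleene chain Fᵏ(∅) becomes stationary, and its limit
-- decides every predicate characterised as the least F-closed one.
module LeastFixedPoint {n : ℕ} (F : Pred (Fin n) 0ℓ → Pred (Fin n) 0ℓ)
  (F-mono : ∀ {A B} → A ⊆′ B → F A ⊆′ F B)
  (F-dec : ∀ {A} → Decidable A → Decidable (F A)) where

  approx : ℕ → Pred (Fin n) 0ℓ
  approx zero    _ = ⊥
  approx (suc k) = F (approx k)

  approx-dec : ∀ k → Decidable (approx k)
  approx-dec zero    _ = no λ ()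
  approx-dec (suc k) = F-dec (approx-dec k)

  approx-increasing : ∀ k → approx k ⊆′ approx (suc k)
  approx-increasing zero    _ ()
  approx-increasing (suc k) = F-mono (approx-increasing k)

  stationary-or-large : ∀ k →
                        ∃ (λ j → F (approx j) ⊆′ approx j) ⊎ k ≤ size (approx-dec k)
  stationary-or-large zero = inj₂ z≤n
  stationary-or-large (suc k) with stationary-or-large k
  ... | inj₁ stationary = inj₁ stationary
  ... | inj₂ large with inclusion-or-escape (approx-dec (suc k)) (approx-dec k)
  ...   | inj₁ stationary = inj₁ (k , stationary)
  ...   | inj₂ new = inj₂ (<-≤-trans (s≤s large) (size-< (approx-dec k) (approx-dec (suc k))
                                                           (approx-increasing k) new))

  -- No predicate on Fin n has n+1 elements, so the chain becomes stationary.
  stationary : ∃ λ j → F (approx j) ⊆′ approx j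
  stationary with stationary-or-large (suc n)
  ... | inj₁ s     = s
  ... | inj₂ large = ⊥-elim (1+n≰n (≤-trans large (size≤n (approx-dec (suc n)))))

  lfp : Pred (Fin n) 0ℓ
  lfp = approx (proj₁ stationary)

  lfp-dec : Decidable lfp
  lfp-dec = approx-dec (proj₁ stationary)

  lfp-closed : F lfp ⊆′ lfp
  lfp-closed = proj₂ stationary

  lfp-least : {I : Pred (Fin n) 0ℓ} → F I ⊆′ I → lfp ⊆′ I
  lfp-least {I} closed = below (proj₁ stationary)
    where
    below : ∀ k → approx k ⊆′ I
    below zero    _ ()
    below (suc k) v a = closed v (F-mono (below k) v a)

  -- A predicate characterised as the least F-closed predicate (typically an
  -- inductive family) coincides with lfp, hence is decidable.
  least-closed-decidable : (A : Pred (Fin n) 0ℓ) → F A ⊆′ A →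
                           ({I : Pred (Fin n) 0ℓ} → F I ⊆′ I → A ⊆′ I) → Decidable A
  least-closed-decidable A closed least v with lfp-dec v
  ... | yes l = yes (lfp-least closed v l)
  ... | no ¬l = no λ a → ¬l (least lfp-closed v a)

≤1∧≢0⇒≡1 : ∀ {m} → m ≤ 1 → m ≢ 0 → m ≡ 1
≤1∧≢0⇒≡1 m≤1 m≢0 = ≤-antisym m≤1 (n≢0⇒n>0 m≢0)

opponent : Fin 2 → Fin 2
opponent zero       = suc zero
opponent (suc zero) = zero

≢⇒≡opponent : ∀ {x p : Fin 2} → x ≢ p → x ≡ opponent p
≢⇒≡opponent {zero}     {zero}     x≢p = ⊥-elim (x≢p refl)
≢⇒≡opponent {zero}     {suc zero} _   = refl
≢⇒≡opponent {suc zero} {zero}     _   = refl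
≢⇒≡opponent {suc zero} {suc zero} x≢p = ⊥-elim (x≢p refl)

≡⇒≢opponent : ∀ {x p : Fin 2} → x ≡ p → x ≢ opponent p
≡⇒≢opponent {p = zero}     refl ()
≡⇒≢opponent {p = suc zero} refl ()

module _ (G : ParityGame) where
  open ParityGame G

  colour≤maxColor : ∀ v → c v ≤ maxColor G
  colour≤maxColor v =
    foldr-preservesᵒ {P = c v ≤_} {f = _⊔_}
      (λ x y → [ m≤n⇒m≤n⊔o y , m≤n⇒m≤o⊔n x ]′)
      0 (map c (allFin n)) (inj₂ (Any.map⁺ (Any.tabulate⁺ v ≤-refl)))

  maxColor≤ : ∀ {m} → (∀ v → c v ≤ m) → maxColor G ≤ m
  maxColor≤ {m} bound =
    foldr-preservesᵇ {P = _≤ m} {f = _⊔_} ⊔-lub z≤n (All.map⁺ (All.tabulate⁺ bound))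

  E? : ∀ v w → Dec (E G v w)
  E? v w = edge v w ≟ᵇ true

  -- CPre p U Z: the nodes of U from which player p forces the play into Z ∩ U in
  -- one step.  Both Attr and MAttr are least fixed points built from it.
  CPre : Fin 2 → NSet G → NSet G → NSet G
  CPre p U Z v = U v × ((owner v ≡ p × ∃ λ w → E G v w × U w × Z w)
                      ⊎ (owner v ≢ p × ∀ w → E G v w → U w → Z w))

  CPre-mono : ∀ {p U A B} → A ⊆′ B → CPre p U A ⊆′ CPre p U B
  CPre-mono A⊆B v (u , inj₁ (o , w , e , uw , a)) = u , inj₁ (o , w , e , uw , A⊆B w a)
  CPre-mono A⊆B v (u , inj₂ (o , all)) = u , inj₂ (o , λ w e uw → A⊆B w (all w e uw))

  CPre-dec : ∀ {p U Z} → Decidable U → Decidable Z → Decidable (CPre p U Z)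
  CPre-dec {p} U? Z? v = U? v ×-dec
    (   (owner v ≟ᶠ p ×-dec any? (λ w → E? v w ×-dec U? w ×-dec Z? w))
    ⊎-dec (¬? (owner v ≟ᶠ p) ×-dec all? (λ w → E? v w →-dec U? w →-dec Z? w)))

  CPre-complement : ∀ {p U Z} → Decidable U → Decidable Z →
                    ∀ {v} → U v → ¬ CPre p U Z v → CPre (opponent p) U (_∖_ G U Z) v
  CPre-complement {p} {U} {Z} U? Z? {v} u ¬cpre with owner v ≟ᶠ p
  ... | yes o =
    u , inj₂ (≡⇒≢opponent o , λ w e uw → uw , λ z → ¬cpre (u , inj₁ (o , w , e , uw , z)))
  ... | no o
    with inclusion-or-escape {P = λ w → E G v w × U w} (λ w → E? v w ×-dec U? w) Z?
  ...   | inj₁ stays  = ⊥-elim (¬cpre (u , inj₂ (o , λ w e uw → stays w (e , uw))))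
  ...   | inj₂ (w , (e , uw) , ¬z) = u , inj₁ (≢⇒≡opponent o , w , e , uw , uw , ¬z)

  AttrStep : Fin 2 → NSet G → NSet G → NSet G → NSet G
  AttrStep p U X Z v = X v ⊎ CPre p U Z v

  Attr-closed : ∀ {p U X} → AttrStep p U X (Attr G p U X) ⊆′ Attr G p U X
  Attr-closed v (inj₁ x) = attr-base x
  Attr-closed v (inj₂ (u , inj₁ (o , w , e , uw , a))) = attr-own w u o e uw a
  Attr-closed v (inj₂ (u , inj₂ (o , all))) = attr-opp u o all

  Attr-least : ∀ {p U X I} → AttrStep p U X I ⊆′ I → Attr G p U X ⊆′ I
  Attr-least closed v (attr-base x) = closed v (inj₁ x)
  Attr-least closed v (attr-own w u o e uw a) =
    closed v (inj₂ (u , inj₁ (o , w , e , uw , Attr-least closed w a)))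
  Attr-least closed v (attr-opp u o all) =
    closed v (inj₂ (u , inj₂ (o , λ w e uw → Attr-least closed w (all w e uw))))

  Attr-dec : ∀ {p U X} → Decidable U → Decidable X → Decidable (Attr G p U X)
  Attr-dec {p} {U} {X} U? X? =
    least-closed-decidable (Attr G p U X) Attr-closed Attr-least
    where
    open LeastFixedPoint (AttrStep p U X)
      (λ A⊆B v → [ inj₁ , (λ cpre → inj₂ (CPre-mono A⊆B v cpre)) ]′)
      (λ Z? v → X? v ⊎-dec CPre-dec U? Z? v)

  MAttrStep : ℕ → NSet G → NSet G → NSet G → NSet G
  MAttrStep d U X Z v = d ≤ c v × CPre (parity d) U (λ w → Z w ⊎ X w) v

  MAttr-closed : ∀ {d U X} → MAttrStep d U X (MAttr G d U X) ⊆′ MAttr G d U X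
  MAttr-closed v (d≤c , u , inj₁ (o , w , e , uw , m)) = mattr-own w u o d≤c e uw m
  MAttr-closed v (d≤c , u , inj₂ (o , all)) = mattr-opp u o d≤c all

  MAttr-least : ∀ {d U X I} → MAttrStep d U X I ⊆′ I → MAttr G d U X ⊆′ I
  MAttr-least {d} {U} {X} {I} closed = least
    where
    least : MAttr G d U X ⊆′ I
    least-or-base : ∀ w → MAttr G d U X w ⊎ X w → I w ⊎ X w
    least v (mattr-own w u o d≤c e uw m) =
      closed v (d≤c , u , inj₁ (o , w , e , uw , least-or-base w m))
    least v (mattr-opp u o d≤c all) =
      closed v (d≤c , u , inj₂ (o , λ w e uw → least-or-base w (all w e uw)))
    least-or-base w (inj₁ m) = inj₁ (least w m)
    least-or-base w (inj₂ x) = inj₂ x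

  MAttr-dec : ∀ {d U X} → Decidable U → Decidable X → Decidable (MAttr G d U X)
  MAttr-dec {d} {U} {X} U? X? =
    least-closed-decidable (MAttr G d U X) MAttr-closed MAttr-least
    where
    open LeastFixedPoint (MAttrStep d U X)
      (λ A⊆B v (d≤c , cpre) →
        d≤c , CPre-mono (λ w → [ (λ a → inj₁ (A⊆B w a)) , inj₂ ]′) v cpre)
      (λ Z? v → (d ≤? c v) ×-dec CPre-dec U? (λ w → Z? w ⊎-dec X? w) v)

  Subgame : NSet G → Set
  Subgame U = ∀ v → U v → ∃ λ w → E G v w × U w

  CPre-successor : ∀ {q U Z} → Subgame U →
                   ∀ {v} → CPre q U Z v → ∃ λ w → E G v w × U w × Z w
  CPre-successor sub (u , inj₁ (_ , successor)) = successor
  CPre-successor sub {v} (u , inj₂ (_ , all)) with sub v u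
  ... | w , e , uw = w , e , uw , all w e uw

  subgame-CPre : ∀ {q U} → Subgame U → U ⊆′ CPre q U U
  subgame-CPre {q} sub v u with owner v ≟ᶠ q | sub v u
  ... | yes o | w , e , uw = u , inj₁ (o , w , e , uw , uw)
  ... | no o  | _          = u , inj₂ (o , λ _ _ uw → uw)

  -- Removing an attractor from a subgame leaves a subgame: the complement of an
  -- attractor is a trap for the attracting player.
  subgame-∖-Attr : ∀ {p U Y} → Decidable U → Decidable Y → Subgame U →
                   Subgame (_∖_ G U (Attr G p U Y))
  subgame-∖-Attr U? Y? sub v (u , ¬a)
    with CPre-successor sub (CPre-complement U? (Attr-dec U? Y?) u
                               (λ cpre → ¬a (Attr-closed v (inj₂ cpre))))
  ... | w , e , _ , outside = w , e , outside

  MonochromeTrap : NSet G → ℕ → NSet G → Set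
  MonochromeTrap U d W = ∀ v → W v → c v ≡ d × CPre (parity d) U W v

  trap⊆MAttr : ∀ {U d X W} → MonochromeTrap U d W → W ⊆′ X → W ⊆′ MAttr G d U X
  trap⊆MAttr trap W⊆X v w with trap v w
  ... | c≡d , cpre =
    MAttr-closed v (≤-reflexive (sym c≡d) , CPre-mono (λ w′ w′∈W → inj₂ (W⊆X w′ w′∈W)) v cpre)

  MAttr⊆U : ∀ {d U X} → MAttr G d U X ⊆′ U
  MAttr⊆U v (mattr-own _ u _ _ _ _ _) = u
  MAttr⊆U v (mattr-opp u _ _ _)       = u

  Solved : NSet G → Set₁
  Solved U = ∃ λ R → PsolB G U R × IsEmpty G R

  LoopSolved : NSet G → ℕ → NSet G → Set₁
  LoopSolved U d X = ∃ λ R → Loop G U d X R × IsEmpty G R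

  module Run {U : NSet G} (U? : Decidable U) (sub : Subgame U)
    (solve-smaller : ∀ {U′} (U′? : Decidable U′) → size U′? < size U? →
                     Subgame U′ → Solved U′)
    where

    -- A nonempty X ⊆ MAttr d U X lies in the attractor removed by psolB, so the
    -- recursive call is on a strictly smaller subgame.
    fatal : ∀ {d X} → Decidable X → ∃ X → X ⊆′ MAttr G d U X → LoopSolved U d X
    fatal {d} {X} X? (v , x) X⊆M =
      let (R , call , empty) = solve-smaller U′? smaller (subgame-∖-Attr U? M? sub)
      in R , recurse (λ empty → empty v x) X⊆M call , empty
      where
      M? = MAttr-dec {d} U? X?
      U′? : Decidable (_∖_ G U (Attr G (parity d) U (MAttr G d U X)))
      U′? w = U? w ×-dec ¬? (Attr-dec U? M? w)
      smaller : size U′? < size U?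
      smaller = size-< U′? U? (λ _ → proj₁)
                  (v , MAttr⊆U v (X⊆M v x) , λ (_ , ¬a) → ¬a (attr-base (X⊆M v x)))

    NoMonochromeTrap : ℕ → Set₁
    NoMonochromeTrap d = ∀ W → MonochromeTrap U d W → IsEmpty G W

    -- Colour suc d: X shrinks while containing every monochrome (suc d)-trap, until
    -- it is fatal or empty; in the latter case there is no such trap, and the run
    -- continues with the next colour d.
    shrinking : ∀ {d} → (NoMonochromeTrap (suc d) → LoopSolved U d (ColorSet G U d)) →
                ∀ k {X} (X? : Decidable X) → size X? < k →
                (∀ W → MonochromeTrap U (suc d) W → W ⊆′ X) → LoopSolved U (suc d) X
    shrinking next zero    X? ()
    shrinking {d} next (suc k) {X} X? small traps⊆X with empty-or-inhabited X?
    ... | inj₁ empty =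
      let (R , loop , emptyR) = next (λ W trap v w → empty v (traps⊆X W trap v w))
      in R , empty-next empty loop , emptyR
    ... | inj₂ (v , x) with inclusion-or-escape X? (MAttr-dec U? X?)
    ...   | inj₁ X⊆M = fatal X? (v , x) X⊆M
    ...   | inj₂ (v′ , x′ , ¬m) =
      let (R , loop , emptyR) = shrinking next k X∩M? smaller traps⊆X∩M
      in R , shrink (λ empty → empty v x) (λ X⊆M → ¬m (X⊆M v′ x′)) loop , emptyR
      where
      X∩M? : Decidable (_∩_ G X (MAttr G (suc d) U X))
      X∩M? w = X? w ×-dec MAttr-dec U? X? w
      smaller : size X∩M? < k
      smaller = <-≤-trans (size-< X∩M? X? (λ _ → proj₁) (v′ , x′ , λ (_ , m) → ¬m m))
                          (≤-pred small)
      traps⊆X∩M : ∀ W → MonochromeTrap U (suc d) W → W ⊆′ _∩_ G X (MAttr G (suc d) U X)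
      traps⊆X∩M W trap w w∈W =
        traps⊆X W trap w w∈W , trap⊆MAttr trap (traps⊆X W trap) w w∈W

    X₀ : NSet G
    X₀ = ColorSet G U 0

    X₀? : Decidable X₀
    X₀? v = U? v ×-dec (c v ≟ 0)

    M₀∪X₀ : NSet G
    M₀∪X₀ w = MAttr G 0 U X₀ w ⊎ X₀ w

    M₀∪X₀? : Decidable M₀∪X₀
    M₀∪X₀? w = MAttr-dec U? X₀? w ⊎-dec X₀? w

    -- If every colour is 0 or 1 and U has no monochrome 1-trap, then every node of
    -- U lies in MAttr 0 U X₀ ∪ X₀: the nodes outside form a monochrome 1-trap.
    covered : (∀ v → c v ≤ 1) → NoMonochromeTrap 1 → U ⊆′ M₀∪X₀
    covered colours≤1 noTrap with inclusion-or-escape U? M₀∪X₀?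
    ... | inj₁ U⊆M₀∪X₀     = U⊆M₀∪X₀
    ... | inj₂ (v , u , ¬z) = ⊥-elim (noTrap (_∖_ G U M₀∪X₀) outside-trap v (u , ¬z))
      where
      outside-trap : MonochromeTrap U 1 (_∖_ G U M₀∪X₀)
      outside-trap w (uw , ¬zw) =
        ≤1∧≢0⇒≡1 (colours≤1 w) (λ c≡0 → ¬zw (inj₂ (uw , c≡0))) ,
        CPre-complement U? M₀∪X₀? uw (λ cpre → ¬zw (inj₁ (MAttr-closed w (z≤n , cpre))))

    -- Colour 0, when colours are at most 1 and U has no monochrome 1-trap: if
    -- X₀ = ∅ then U itself is a monochrome 1-trap, hence empty; otherwise X₀ is fatal.
    bottom : (∀ v → c v ≤ 1) → NoMonochromeTrap 1 → LoopSolved U 0 X₀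
    bottom colours≤1 noTrap with empty-or-inhabited X₀?
    ... | inj₁ empty = U , empty-done empty , noTrap U U-trap
      where
      U-trap : MonochromeTrap U 1 U
      U-trap v u =
        ≤1∧≢0⇒≡1 (colours≤1 v) (λ c≡0 → empty v (u , c≡0)) , subgame-CPre sub v u
    ... | inj₂ inhabited = fatal X₀? inhabited X₀⊆M
      where
      X₀⊆M : X₀ ⊆′ MAttr G 0 U X₀
      X₀⊆M v (u , _) =
        MAttr-closed v (z≤n , CPre-mono (covered colours≤1 noTrap) v (subgame-CPre sub v u))

    start : ∀ {m} → (∀ v → c v ≤ m) → m ≤ 1 → LoopSolved U m (ColorSet G U m)
    start {zero} bound _ = bottom (λ v → ≤-trans (bound v) z≤n) noTrap
      where
      noTrap : NoMonochromeTrap 1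
      noTrap W trap v w = 1+n≰n (≤-trans (≤-reflexive (sym (proj₁ (trap v w)))) (bound v))
    start {suc zero} bound _ = shrinking (bottom bound) (suc (size X₁?)) X₁? ≤-refl traps⊆X₁
      where
      X₁? : Decidable (ColorSet G U 1)
      X₁? v = U? v ×-dec (c v ≟ 1)
      traps⊆X₁ : ∀ W → MonochromeTrap U 1 W → W ⊆′ ColorSet G U 1
      traps⊆X₁ W trap v w = let (c≡1 , u , _) = trap v w in u , c≡1
    start {suc (suc _)} _ (s≤s ())

  solve : (∀ v → c v ≤ 1) → ∀ k {U} (U? : Decidable U) → size U? < k → Subgame U → Solved U
  solve colours≤1 zero    U? ()
  solve colours≤1 (suc k) U? small sub =
    let (R , loop , empty) = Run.start U? sub smaller colour≤maxColor (maxColor≤ colours≤1)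
    in R , run loop , empty
    where
    smaller : ∀ {U′} (U′? : Decidable U′) → size U′? < size U? → Subgame U′ → Solved U′
    smaller U′? U′<U = solve colours≤1 k U′? (<-≤-trans U′<U (≤-pred small))

theorem7 : (G : ParityGame) →
    (∀ v → ParityGame.c G v ≤ 1) →
    ∃ λ R → PsolB G (Full G) R × IsEmpty G R
theorem7 G colours≤1 = solve G colours≤1 (suc (size Full?)) Full? ≤-refl total
  where
  Full? : Decidable (Full G)
  Full? _ = yes tt
  total : Subgame G (Full G)
  total v _ = let (w , e) = ParityGame.total G v in w , e , tt
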